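{- Let $t_1,t_2,d$ be positive integers. Then $$N(K_{t_1,t_2},1;d)\leq N((1,1;d),t_1)+N((1,1;d),t_2).$$
   Context: $K_{t_1,t_2}$ is the complete bipartite graph with parts of sizes $t_1,t_2$. An $(r,w;d)$-CFF$(n,t)$ is a pair $(X,B)$ with $|X|=n$ and $B=\{B_1,\ldots,B_t\}$ subsets of $X$ such that for any $L,M\subseteq[t]$ with $L\cap M=\emptyset$, $|L|=r$, $|M|=w$, we have $|(\bigcap_{l\in L}B_l)\setminus(\bigcup_{m\in M}B_m)|\geq d$; $N((r,w;d),t)$ is the minimum $n$ for which one exists. For a graph $G$, a collection $\{A_1,\ldots,A_n\}$ of subsets of $V(G)$ is a $(w,d)$-covering of $G$ if for every edge $\{u,v\}$ and every $w$-subset $W\subseteq V(G)$ disjoint from $\{u,v\}$ there are at least $d$ sets $A_j$ with $\{u,v\}\subseteq A_j$ and $W\cap A_j=\emptyset$; $N(G,w;d)$ is the minimum size of a $(w,d)$-covering of $G$. -}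

module Defs where

open import Data.Nat using (ℕ; zero; suc; _+_; _≤_)
open import Data.Bool using (Bool; true; false; _∧_; _∨_; not; T)
open import Data.Fin using (Fin; zero; suc; splitAt)
open import Data.Fin.Subset using (Subset; inside; outside; ∣_∣; _∩_; Empty)
open import Data.Vec using (lookup; tabulate)
open import Data.Sum using (inj₁; inj₂)
open import Data.Product using (Σ; _×_)
open import Relation.Binary.PropositionalEquality using (_≡_)

isIn : ∀ {n} → Subset n → Fin n → Bool
isIn p x with lookup p x
... | inside  = true
... | outside = false

fromBool : Bool → Data.Fin.Subset.Side
fromBool true  = inside
fromBool false = outside

allFin : ∀ t → (Fin t → Bool) → Bool
allFin zero    f = true
allFin (suc t) f = f zero ∧ allFin t (λ i → f (suc i))

anyFin : ∀ t → (Fin t → Bool) → Bool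
anyFin zero    f = false
anyFin (suc t) f = f zero ∨ anyFin t (λ i → f (suc i))

IsMinimum : (ℕ → Set) → ℕ → Set
IsMinimum P m = P m × (∀ k → P k → m ≤ k)

-- (r,w;d)-cover-free families.  X = Fin n, B = (B_1,…,B_t) : Fin t → Subset n.
-- For L ∩ M = ∅, |L| = r, |M| = w :  |(⋂_{l∈L} B_l) ∖ (⋃_{m∈M} B_m)| ≥ d.

goodPoints : ∀ {n t} → (Fin t → Subset n) → Subset t → Subset t → Subset n
goodPoints {n} {t} B L M = tabulate λ x →
  fromBool ( allFin t (λ l → not (isIn L l) ∨ isIn (B l) x)
           ∧ not (anyFin t (λ m → isIn M m ∧ isIn (B m) x)) )

IsCFF : (r w d n t : ℕ) → (Fin t → Subset n) → Set
IsCFF r w d n t B =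
  (L M : Subset t) → ∣ L ∣ ≡ r → ∣ M ∣ ≡ w → Empty (L ∩ M) →
  d ≤ ∣ goodPoints B L M ∣

CFFExists : (r w d t : ℕ) → ℕ → Set
CFFExists r w d t n = Σ (Fin t → Subset n) (IsCFF r w d n t)

IsN-CFF : (r w d t : ℕ) → ℕ → Set
IsN-CFF r w d t = IsMinimum (CFFExists r w d t)

record Graph : Set₁ where
  field
    nV  : ℕ
    Adj : Fin nV → Fin nV → Set

open Graph public

-- complete bipartite graph K_{t1,t2}: vertices Fin (t1 + t2), the first t1
-- form one part, the remaining t2 the other; edges exactly between parts.
sideOf : ∀ {t1 t2} → Fin (t1 + t2) → Bool
sideOf {t1} {t2} x with splitAt t1 {t2} x
... | inj₁ _ = true
... | inj₂ _ = false

K : ℕ → ℕ → Graph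
K t1 t2 = record { nV = t1 + t2 ; Adj = λ u v → T (not (sideOf {t1} {t2} u) ∧ sideOf {t1} {t2} v ∨ sideOf {t1} {t2} u ∧ not (sideOf {t1} {t2} v)) }

goodSets : ∀ {v n} → (Fin n → Subset v) → Fin v → Fin v → Subset v → Subset n
goodSets {v} A u u' W = tabulate λ j →
  fromBool (isIn (A j) u ∧ isIn (A j) u' ∧ not (anyFin v (λ z → isIn W z ∧ isIn (A j) z)))

IsCovering : (G : Graph) (w d n : ℕ) → (Fin n → Subset (nV G)) → Set
IsCovering G w d n A =
  (u u' : Fin (nV G)) → Adj G u u' →
  (W : Subset (nV G)) → ∣ W ∣ ≡ w → T (not (isIn W u)) → T (not (isIn W u')) →
  d ≤ ∣ goodSets A u u' W ∣

CoveringExists : (G : Graph) (w d : ℕ) → ℕ → Set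
CoveringExists G w d n = Σ (Fin n → Subset (nV G)) (IsCovering G w d n)

IsN-Cov : (G : Graph) (w d : ℕ) → ℕ → Set
IsN-Cov G w d = IsMinimum (CoveringExists G w d)

-- Let B¹ and B² be (1,1;d)-CFFs on point sets X₁ and X₂. Index vertex sets of
-- K_{t₁,t₂} by X₁ ⊔ X₂: a point j ∈ X₁ gives {a : j ∈ B¹_a} together with the
-- whole second part, and symmetrically for X₂. For an edge {a,b} and a forbidden
-- vertex z ≠ a in the first part, the at least d points of B¹_a ∖ B¹_z give sets
-- containing a and b but not z; a z in the second part is handled by B².

module Submission where

open import Defs
open import Data.Nat using (ℕ; zero; suc; _+_; _≤_; z≤n; s≤s)
open import Data.Nat.Properties using (≤-trans; suc-injective)
open import Data.Bool using (Bool; true; false; _∧_; not; T)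
open import Data.Bool.Properties using (T-≡; T-∧; T-∨; ∧-assoc; ∧-comm)
open import Data.Fin using (Fin; zero; suc; splitAt; _↑ˡ_; _↑ʳ_)
open import Data.Fin.Properties using (splitAt-↑ˡ; splitAt-↑ʳ; splitAt⁻¹-↑ˡ; splitAt⁻¹-↑ʳ)
open import Data.Fin.Subset using (Subset; inside; outside; ∣_∣; _∈_; _∉_; ⁅_⁆; ⊥; _∩_; Empty)
open import Data.Fin.Subset.Properties
  using (x∈⁅x⁆; x∈⁅y⁆⇒x≡y; ∣⁅x⁆∣≡1; x∈p∩q⁻; p⊆q⇒∣p∣≤∣q∣; ∣p∣≤∣x∷p∣; drop-there)
open import Data.Vec using (_∷_; []; lookup; tabulate; here; there)
open import Data.Vec.Properties using (lookup∘tabulate; tabulate-cong; lookup⇒[]=; []=⇒lookup)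
open import Data.Sum using (inj₁; inj₂)
open import Data.Product using (∃; _×_; _,_; proj₁; proj₂)
open import Data.Empty using (⊥-elim)
open import Function using (_∘_)
open import Function.Bundles using (Equivalence)
open import Relation.Nullary using (¬_)
open import Relation.Binary.PropositionalEquality
  using (_≡_; _≢_; refl; sym; trans; cong; subst)

open Equivalence using (to; from)

T-not⁻ : ∀ {b} → T (not b) → ¬ T b
T-not⁻ {false} _ ()

T-not⁺ : ∀ {b} → ¬ T b → T (not b)
T-not⁺ {false} _  = _
T-not⁺ {true}  ¬b = ¬b _

∧-swapˡ : ∀ x y z → x ∧ y ∧ z ≡ y ∧ x ∧ z
∧-swapˡ x y z = trans (sym (∧-assoc x y z)) (trans (cong (_∧ z) (∧-comm x y)) (∧-assoc y x z))

T-allFin⁻ : ∀ t {f : Fin t → Bool} → T (allFin t f) → ∀ i → T (f i)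
T-allFin⁻ (suc t) all zero    = proj₁ (to T-∧ all)
T-allFin⁻ (suc t) all (suc i) = T-allFin⁻ t (proj₂ (to T-∧ all)) i

T-anyFin⁺ : ∀ t {f : Fin t → Bool} i → T (f i) → T (anyFin t f)
T-anyFin⁺ (suc t) zero    fi = from T-∨ (inj₁ fi)
T-anyFin⁺ (suc t) (suc i) fi = from T-∨ (inj₂ (T-anyFin⁺ t i fi))

T-anyFin⁻ : ∀ t {f : Fin t → Bool} → T (anyFin t f) → ∃ (T ∘ f)
T-anyFin⁻ (suc t) any with to T-∨ any
... | inj₁ f0   = zero , f0
... | inj₂ rest with T-anyFin⁻ t rest
...   | i , fi = suc i , fi

T-isIn⁺ : ∀ {n} {p : Subset n} {x} → x ∈ p → T (isIn p x)
T-isIn⁺ {p = p} {x} x∈p rewrite []=⇒lookup x∈p = _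

T-isIn⁻ : ∀ {n} {p : Subset n} {x} → T (isIn p x) → x ∈ p
T-isIn⁻ {p = p} {x} px with lookup p x in eq
... | inside = lookup⇒[]= x p eq

∈-tabulate⁺ : ∀ {n} {f : Fin n → Bool} {x} → T (f x) → x ∈ tabulate (fromBool ∘ f)
∈-tabulate⁺ {f = f} {x} fx =
  lookup⇒[]= x _ (trans (lookup∘tabulate (fromBool ∘ f) x) (cong fromBool (to T-≡ fx)))

∈-tabulate⁻ : ∀ {n} {f : Fin n → Bool} {x} → x ∈ tabulate (fromBool ∘ f) → T (f x)
∈-tabulate⁻ {f = f} {x} x∈ with f x | trans (sym ([]=⇒lookup x∈)) (lookup∘tabulate (fromBool ∘ f) x)
... | true | _ = _

∣p∣≡0⇒p≡⊥ : ∀ {n} (p : Subset n) → ∣ p ∣ ≡ 0 → p ≡ ⊥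
∣p∣≡0⇒p≡⊥ []            _ = refl
∣p∣≡0⇒p≡⊥ (outside ∷ p) e = cong (outside ∷_) (∣p∣≡0⇒p≡⊥ p e)

∣p∣≡1⇒p≡⁅x⁆ : ∀ {n} (p : Subset n) → ∣ p ∣ ≡ 1 → ∃ λ x → p ≡ ⁅ x ⁆
∣p∣≡1⇒p≡⁅x⁆ (inside  ∷ p) e = zero , cong (inside ∷_) (∣p∣≡0⇒p≡⊥ p (suc-injective e))
∣p∣≡1⇒p≡⁅x⁆ (outside ∷ p) e with ∣p∣≡1⇒p≡⁅x⁆ p e
... | x , p≡⁅x⁆ = suc x , cong (outside ∷_) p≡⁅x⁆

⁅x⁆∩⁅y⁆-Empty : ∀ {n} {x y : Fin n} → x ≢ y → Empty (⁅ x ⁆ ∩ ⁅ y ⁆)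
⁅x⁆∩⁅y⁆-Empty {x = x} {y} x≢y (z , z∈) with x∈p∩q⁻ ⁅ x ⁆ ⁅ y ⁆ z∈
... | z∈⁅x⁆ , z∈⁅y⁆ = x≢y (trans (sym (x∈⁅y⁆⇒x≡y x z∈⁅x⁆)) (x∈⁅y⁆⇒x≡y y z∈⁅y⁆))

∣p∣≤∣q∣-↑ˡ : ∀ {m} n {p : Subset m} {q : Subset (m + n)} →
             (∀ {j} → j ∈ p → j ↑ˡ n ∈ q) → ∣ p ∣ ≤ ∣ q ∣
∣p∣≤∣q∣-↑ˡ n {[]}          {q}     _   = z≤n
∣p∣≤∣q∣-↑ˡ n {inside  ∷ p} {s ∷ q} p⊆q with p⊆q here
... | here = s≤s (∣p∣≤∣q∣-↑ˡ n (drop-there ∘ p⊆q ∘ there))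
∣p∣≤∣q∣-↑ˡ n {outside ∷ p} {s ∷ q} p⊆q =
  ≤-trans (∣p∣≤∣q∣-↑ˡ n (drop-there ∘ p⊆q ∘ there)) (∣p∣≤∣x∷p∣ s q)

∣p∣≤∣q∣-↑ʳ : ∀ m {n} {p : Subset n} {q : Subset (m + n)} →
             (∀ {j} → j ∈ p → m ↑ʳ j ∈ q) → ∣ p ∣ ≤ ∣ q ∣
∣p∣≤∣q∣-↑ʳ zero              p⊆q = p⊆q⇒∣p∣≤∣q∣ p⊆q
∣p∣≤∣q∣-↑ʳ (suc m) {q = s ∷ q} p⊆q =
  ≤-trans (∣p∣≤∣q∣-↑ʳ m (drop-there ∘ p⊆q)) (∣p∣≤∣x∷p∣ s q)

∈-goodPoints-⁅⁆⁻ : ∀ {n t} (B : Fin t → Subset n) {a z j} →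
                   j ∈ goodPoints B ⁅ a ⁆ ⁅ z ⁆ → j ∈ B a × j ∉ B z
∈-goodPoints-⁅⁆⁻ {t = t} B {a} {z} {j} j∈ with to T-∧ (∈-tabulate⁻ j∈)
... | all , none = T-isIn⁻ j∈Ba , j∉Bz
  where
  j∈Ba : T (isIn (B a) j)
  j∈Ba with to T-∨ (T-allFin⁻ t all a)
  ... | inj₁ a∉⁅a⁆ = ⊥-elim (T-not⁻ a∉⁅a⁆ (T-isIn⁺ (x∈⁅x⁆ a)))
  ... | inj₂ j∈Ba = j∈Ba
  j∉Bz : j ∉ B z
  j∉Bz j∈Bz = T-not⁻ none (T-anyFin⁺ t z (from T-∧ (T-isIn⁺ (x∈⁅x⁆ z) , T-isIn⁺ j∈Bz)))

IsCFF₁₁⇒separates : ∀ {d n t} (B : Fin t → Subset n) → IsCFF 1 1 d n t B →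
                    ∀ {a z} → a ≢ z → d ≤ ∣ goodPoints B ⁅ a ⁆ ⁅ z ⁆ ∣
IsCFF₁₁⇒separates B cff {a} {z} a≢z = cff ⁅ a ⁆ ⁅ z ⁆ (∣⁅x⁆∣≡1 a) (∣⁅x⁆∣≡1 z) (⁅x⁆∩⁅y⁆-Empty a≢z)

∈-goodSets-⁅⁆⁺ : ∀ {v n} (A : Fin n → Subset v) {u u' z j} →
                 u ∈ A j → u' ∈ A j → z ∉ A j → j ∈ goodSets A u u' ⁅ z ⁆
∈-goodSets-⁅⁆⁺ {v} A {z = z} {j} u∈ u'∈ z∉ =
  ∈-tabulate⁺ (from T-∧ (T-isIn⁺ u∈ , from T-∧ (T-isIn⁺ u'∈ , T-not⁺ onlyZ)))
  where
  onlyZ : ¬ T (anyFin v (λ y → isIn ⁅ z ⁆ y ∧ isIn (A j) y))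
  onlyZ any with T-anyFin⁻ v any
  ... | y , hit with to T-∧ hit
  ... | y∈⁅z⁆ , y∈Aj = z∉ (subst (_∈ A j) (x∈⁅y⁆⇒x≡y z (T-isIn⁻ y∈⁅z⁆)) (T-isIn⁻ y∈Aj))

goodSets-comm : ∀ {v n} (A : Fin n → Subset v) u u' W → goodSets A u u' W ≡ goodSets A u' u W
goodSets-comm A u u' W = tabulate-cong λ j → cong fromBool (∧-swapˡ (isIn (A j) u) (isIn (A j) u') _)

data Part (t₁ t₂ : ℕ) : Fin (t₁ + t₂) → Set where
  left  : ∀ a → Part t₁ t₂ (a ↑ˡ t₂)
  right : ∀ b → Part t₁ t₂ (t₁ ↑ʳ b)

part : ∀ t₁ {t₂} (x : Fin (t₁ + t₂)) → Part t₁ t₂ x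
part t₁ x with splitAt t₁ x in eq
... | inj₁ a = subst (Part _ _) (splitAt⁻¹-↑ˡ eq) (left a)
... | inj₂ b = subst (Part _ _) (splitAt⁻¹-↑ʳ eq) (right b)

sideOf-↑ˡ : ∀ {t₁ t₂} (a : Fin t₁) → sideOf {t₁} {t₂} (a ↑ˡ t₂) ≡ true
sideOf-↑ˡ {t₁} {t₂} a rewrite splitAt-↑ˡ t₁ a t₂ = refl

sideOf-↑ʳ : ∀ {t₁ t₂} (b : Fin t₂) → sideOf {t₁} {t₂} (t₁ ↑ʳ b) ≡ false
sideOf-↑ʳ {t₁} {t₂} b rewrite splitAt-↑ʳ t₁ t₂ b = refl

K-¬Adj-↑ˡ : ∀ {t₁ t₂} (a a' : Fin t₁) → ¬ Adj (K t₁ t₂) (a ↑ˡ t₂) (a' ↑ˡ t₂)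
K-¬Adj-↑ˡ {t₁} {t₂} a a' rewrite sideOf-↑ˡ {t₁} {t₂} a | sideOf-↑ˡ {t₁} {t₂} a' = λ ()

K-¬Adj-↑ʳ : ∀ {t₁ t₂} (b b' : Fin t₂) → ¬ Adj (K t₁ t₂) (t₁ ↑ʳ b) (t₁ ↑ʳ b')
K-¬Adj-↑ʳ {t₁} {t₂} b b' rewrite sideOf-↑ʳ {t₁} {t₂} b | sideOf-↑ʳ {t₁} {t₂} b' = λ ()

module BipartiteCovering {t₁ t₂ n₁ n₂ : ℕ}
                         (B¹ : Fin t₁ → Subset n₁) (B² : Fin t₂ → Subset n₂) where

  incidence : Fin (n₁ + n₂) → Fin (t₁ + t₂) → Bool
  incidence j x with splitAt n₁ j | splitAt t₁ x
  ... | inj₁ j₁ | inj₁ a = isIn (B¹ a) j₁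
  ... | inj₁ _  | inj₂ _ = true
  ... | inj₂ _  | inj₁ _ = true
  ... | inj₂ j₂ | inj₂ b = isIn (B² b) j₂

  covering : Fin (n₁ + n₂) → Subset (t₁ + t₂)
  covering j = tabulate (fromBool ∘ incidence j)

  incidence-↑ˡ-↑ˡ : ∀ j a → incidence (j ↑ˡ n₂) (a ↑ˡ t₂) ≡ isIn (B¹ a) j
  incidence-↑ˡ-↑ˡ j a rewrite splitAt-↑ˡ n₁ j n₂ | splitAt-↑ˡ t₁ a t₂ = refl

  incidence-↑ˡ-↑ʳ : ∀ j b → incidence (j ↑ˡ n₂) (t₁ ↑ʳ b) ≡ true
  incidence-↑ˡ-↑ʳ j b rewrite splitAt-↑ˡ n₁ j n₂ | splitAt-↑ʳ t₁ t₂ b = refl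

  incidence-↑ʳ-↑ˡ : ∀ j a → incidence (n₁ ↑ʳ j) (a ↑ˡ t₂) ≡ true
  incidence-↑ʳ-↑ˡ j a rewrite splitAt-↑ʳ n₁ n₂ j | splitAt-↑ˡ t₁ a t₂ = refl

  incidence-↑ʳ-↑ʳ : ∀ j b → incidence (n₁ ↑ʳ j) (t₁ ↑ʳ b) ≡ isIn (B² b) j
  incidence-↑ʳ-↑ʳ j b rewrite splitAt-↑ʳ n₁ n₂ j | splitAt-↑ʳ t₁ t₂ b = refl

  ↑ˡ∈covering-↑ˡ⁺ : ∀ {j a} → j ∈ B¹ a → a ↑ˡ t₂ ∈ covering (j ↑ˡ n₂)
  ↑ˡ∈covering-↑ˡ⁺ {j} {a} j∈ = ∈-tabulate⁺ (subst T (sym (incidence-↑ˡ-↑ˡ j a)) (T-isIn⁺ j∈))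

  ↑ˡ∈covering-↑ˡ⁻ : ∀ {j a} → a ↑ˡ t₂ ∈ covering (j ↑ˡ n₂) → j ∈ B¹ a
  ↑ˡ∈covering-↑ˡ⁻ {j} {a} a∈ = T-isIn⁻ (subst T (incidence-↑ˡ-↑ˡ j a) (∈-tabulate⁻ a∈))

  ↑ʳ∈covering-↑ˡ : ∀ {j b} → t₁ ↑ʳ b ∈ covering (j ↑ˡ n₂)
  ↑ʳ∈covering-↑ˡ {j} {b} = ∈-tabulate⁺ (subst T (sym (incidence-↑ˡ-↑ʳ j b)) _)

  ↑ˡ∈covering-↑ʳ : ∀ {j a} → a ↑ˡ t₂ ∈ covering (n₁ ↑ʳ j)
  ↑ˡ∈covering-↑ʳ {j} {a} = ∈-tabulate⁺ (subst T (sym (incidence-↑ʳ-↑ˡ j a)) _)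

  ↑ʳ∈covering-↑ʳ⁺ : ∀ {j b} → j ∈ B² b → t₁ ↑ʳ b ∈ covering (n₁ ↑ʳ j)
  ↑ʳ∈covering-↑ʳ⁺ {j} {b} j∈ = ∈-tabulate⁺ (subst T (sym (incidence-↑ʳ-↑ʳ j b)) (T-isIn⁺ j∈))

  ↑ʳ∈covering-↑ʳ⁻ : ∀ {j b} → t₁ ↑ʳ b ∈ covering (n₁ ↑ʳ j) → j ∈ B² b
  ↑ʳ∈covering-↑ʳ⁻ {j} {b} b∈ = T-isIn⁻ (subst T (incidence-↑ʳ-↑ʳ j b) (∈-tabulate⁻ b∈))

  module _ {d : ℕ} (c¹ : IsCFF 1 1 d n₁ t₁ B¹) (c² : IsCFF 1 1 d n₂ t₂ B²) where

    crossEdge-covered : ∀ a b z → a ↑ˡ t₂ ∉ ⁅ z ⁆ → t₁ ↑ʳ b ∉ ⁅ z ⁆ →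
                        d ≤ ∣ goodSets covering (a ↑ˡ t₂) (t₁ ↑ʳ b) ⁅ z ⁆ ∣
    crossEdge-covered a b z a∉ b∉ with part t₁ z
    ... | left z₁ = ≤-trans (IsCFF₁₁⇒separates B¹ c¹ a≢z₁) (∣p∣≤∣q∣-↑ˡ n₂ lift)
      where
      a≢z₁ : a ≢ z₁
      a≢z₁ refl = a∉ (x∈⁅x⁆ _)
      lift : ∀ {j} → j ∈ goodPoints B¹ ⁅ a ⁆ ⁅ z₁ ⁆ →
             j ↑ˡ n₂ ∈ goodSets covering (a ↑ˡ t₂) (t₁ ↑ʳ b) ⁅ z₁ ↑ˡ t₂ ⁆
      lift j∈ with ∈-goodPoints-⁅⁆⁻ B¹ {a} {z₁} j∈
      ... | j∈Ba , j∉Bz = ∈-goodSets-⁅⁆⁺ covering {z = z₁ ↑ˡ t₂}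
                            (↑ˡ∈covering-↑ˡ⁺ j∈Ba) ↑ʳ∈covering-↑ˡ (j∉Bz ∘ ↑ˡ∈covering-↑ˡ⁻)
    ... | right z₂ = ≤-trans (IsCFF₁₁⇒separates B² c² b≢z₂) (∣p∣≤∣q∣-↑ʳ n₁ lift)
      where
      b≢z₂ : b ≢ z₂
      b≢z₂ refl = b∉ (x∈⁅x⁆ _)
      lift : ∀ {j} → j ∈ goodPoints B² ⁅ b ⁆ ⁅ z₂ ⁆ →
             n₁ ↑ʳ j ∈ goodSets covering (a ↑ˡ t₂) (t₁ ↑ʳ b) ⁅ t₁ ↑ʳ z₂ ⁆
      lift j∈ with ∈-goodPoints-⁅⁆⁻ B² {b} {z₂} j∈
      ... | j∈Bb , j∉Bz = ∈-goodSets-⁅⁆⁺ covering {z = t₁ ↑ʳ z₂}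
                            ↑ˡ∈covering-↑ʳ (↑ʳ∈covering-↑ʳ⁺ j∈Bb) (j∉Bz ∘ ↑ʳ∈covering-↑ʳ⁻)

    isCovering : IsCovering (K t₁ t₂) 1 d (n₁ + n₂) covering
    isCovering u u' adj W ∣W∣≡1 u∉W u'∉W with ∣p∣≡1⇒p≡⁅x⁆ W ∣W∣≡1
    ... | z , refl with part t₁ u | part t₁ u'
    ... | left a  | left a'  = ⊥-elim (K-¬Adj-↑ˡ {t₁} a a' adj)
    ... | right b | right b' = ⊥-elim (K-¬Adj-↑ʳ {t₁} b b' adj)
    ... | left a  | right b  = crossEdge-covered a b z (T-not⁻ u∉W ∘ T-isIn⁺) (T-not⁻ u'∉W ∘ T-isIn⁺)
    ... | right b | left a   = subst (λ S → d ≤ ∣ S ∣) (goodSets-comm covering _ _ ⁅ z ⁆)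
                                 (crossEdge-covered a b z (T-not⁻ u'∉W ∘ T-isIn⁺) (T-not⁻ u∉W ∘ T-isIn⁺))

proposition3p3 : (t₁ t₂ d : ℕ) → 1 ≤ t₁ → 1 ≤ t₂ → 1 ≤ d →
    (n₁ n₂ m : ℕ) →
    IsN-CFF 1 1 d t₁ n₁ → IsN-CFF 1 1 d t₂ n₂ → IsN-Cov (K t₁ t₂) 1 d m →
    m ≤ n₁ + n₂
proposition3p3 t₁ t₂ d _ _ _ n₁ n₂ m ((B¹ , c¹) , _) ((B² , c²) , _) (_ , minimal) =
  minimal (n₁ + n₂) (covering , isCovering c¹ c²)
  where open BipartiteCovering B¹ B²
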